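{- Let $F$ be a face of $ASM_n$ such that every vertex of $\mathcal G(F)$ has even degree, and let $(i,j)$ be an internal grid position. Then $\frac{a_{ij}+b_{ij}}{2}$ is the same for every pair $\{A,B\}$ of vertices $A=(a_{ij}),B=(b_{ij})$ of $F$ that are estranged in $F$.
   Context: An $n\times n$ alternating sign matrix (ASM) is a matrix with entries in $\{0,1,-1\}$ whose rows and columns each sum to $1$ and in which the nonzero entries of each row and of each column alternate in sign. $ASM_n\subset\mathbb{R}^{n\times n}$ is the convex hull of all $n\times n$ ASMs; its vertices are exactly the $n\times n$ ASMs. Grid: internal vertices $(i,j)$, $1\le i,j\le n$ (row index $i$ increasing downward), and boundary vertices $(i,0),(i,n+1),(0,j),(n+1,j)$; grid edges join each internal $(i,j)$ to $(i,j\pm1)$ and $(i\pm1,j)$. The simple flow grid $g(A)$ of an ASM $A=(a_{ij})$ orients every grid edge exactly once: the edge between $(i,j)$ and $(i+1,j)$ is directed from $(i,j)$ to $(i+1,j)$ if $\sum_{i'\le i}a_{i'j}=1$ and the opposite way otherwise; the edge between $(i,j)$ and $(i,j+1)$ is directed from $(i,j)$ to $(i,j+1)$ if $\sum_{j'\le j}a_{ij'}=1$ and the opposite way otherwise. For a face $F$, the elementary flow grid $g(F)$ has as arc set the union of the arc sets of $g(A)$ over the vertices $A$ of $F$. A grid edge is doubly directed in $g(F)$ if both orientations occur. The doubly directed graph $\mathcal G(F)$ is the undirected graph whose edges are the doubly directed grid edges of $g(F)$ and whose vertices are the grid vertices incident to at least one such edge. Vertices $A,B$ of a face $F$ are estranged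 in $F$ if there is no proper face of $F$ containing both $A$ and $B$. -}

module Defs where

open import Data.Nat as ℕ using (ℕ; zero; suc; _≤_)
open import Data.Nat.Divisibility using (_∣_)
open import Data.Nat.Properties using (_<?_)
open import Data.Fin as Fin using (Fin; fromℕ<)
open import Data.Integer as ℤ using (ℤ; 0ℤ; 1ℤ; -1ℤ; _+_; _*_)
open import Data.Integer.Properties using () renaming (_≟_ to _≟ℤ_)
open import Data.List using (List; []; _∷_; _++_)
open import Data.Product using (Σ; _×_; _,_; ∃)
open import Data.Sum using (_⊎_)
open import Data.Bool using (Bool; true; false)
open import Relation.Nullary using (¬_; yes; no)
open import Relation.Binary.PropositionalEquality using (_≡_; _≢_)

Matrix : ℕ → Set
Matrix n = Fin n → Fin n → ℤ

-- 1-based access on the grid: at A i j = a_{ij} for 1 ≤ i,j ≤ n, and 0 otherwise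
at : {n : ℕ} → Matrix n → ℕ → ℕ → ℤ
at {n} A (suc i) (suc j) with i <? n | j <? n
... | yes p | yes q = A (fromℕ< p) (fromℕ< q)
... | _     | _     = 0ℤ
at A _ _ = 0ℤ

sumTo : ℕ → (ℕ → ℤ) → ℤ
sumTo zero    f = 0ℤ
sumTo (suc k) f = sumTo k f + f (suc k)

colPS : {n : ℕ} → Matrix n → ℕ → ℕ → ℤ
colPS A i j = sumTo i (λ i' → at A i' j)

rowPS : {n : ℕ} → Matrix n → ℕ → ℕ → ℤ
rowPS A i j = sumTo j (λ j' → at A i j')

IsASM : {n : ℕ} → Matrix n → Set
IsASM {n} A =
  (∀ i j → A i j ≡ 0ℤ ⊎ (A i j ≡ 1ℤ ⊎ A i j ≡ -1ℤ))
  × (∀ i → 1 ≤ i → i ≤ n → rowPS A i n ≡ 1ℤ)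
  × (∀ j → 1 ≤ j → j ≤ n → colPS A n j ≡ 1ℤ)
  × (∀ (i j j' : Fin n) → j Fin.< j' → A i j ≢ 0ℤ → A i j' ≢ 0ℤ →
       (∀ k → j Fin.< k → k Fin.< j' → A i k ≡ 0ℤ) →
       (A i j * A i j') ℤ.< 0ℤ)
  × (∀ (j i i' : Fin n) → i Fin.< i' → A i j ≢ 0ℤ → A i' j ≢ 0ℤ →
       (∀ k → i Fin.< k → k Fin.< i' → A k j ≡ 0ℤ) →
       (A i j * A i' j) ℤ.< 0ℤ)

-- Faces of ASM_n, represented by their vertex sets.
-- The vertices of ASM_n are exactly the ASMs.  Every nonempty face of
-- the (integral) polytope ASM_n is the set of maximisers of a linear
-- functional ⟨c,-⟩, and c may be taken integral.

pair : {n : ℕ} → Matrix n → Matrix n → ℤ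
pair {n} c M = sumTo n (λ i → sumTo n (λ j → at c i j * at M i j))

FaceV : {n : ℕ} → Matrix n → Matrix n → Set
FaceV {n} c A = IsASM A × (∀ (B : Matrix n) → IsASM B → pair c B ℤ.≤ pair c A)

_⊆F_ : {n : ℕ} → Matrix n → Matrix n → Set
_⊆F_ {n} c' c = ∀ (M : Matrix n) → FaceV c' M → FaceV c M

Estranged : {n : ℕ} → Matrix n → Matrix n → Matrix n → Set
Estranged {n} c A B =
  FaceV c A × FaceV c B ×
  (∀ (c' : Matrix n) → c' ⊆F c → FaceV c' A → FaceV c' B → c ⊆F c')

GridVertex : Set
GridVertex = ℕ × ℕ

-- vE i j : edge between (i,j) and (i+1,j)
-- hE i j : edge between (i,j) and (i,j+1)
data Edge : Set where
  vE : ℕ → ℕ → Edge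
  hE : ℕ → ℕ → Edge

IsGridEdge : ℕ → Edge → Set
IsGridEdge n (vE i j) = i ≤ n × 1 ≤ j × j ≤ n
IsGridEdge n (hE i j) = 1 ≤ i × i ≤ n × j ≤ n

first second : Edge → GridVertex
first  (vE i j) = (i , j)
first  (hE i j) = (i , j)
second (vE i j) = (suc i , j)
second (hE i j) = (i , suc j)

Forward : {n : ℕ} → Matrix n → Edge → Set
Forward A (vE i j) = colPS A i j ≡ 1ℤ
Forward A (hE i j) = rowPS A i j ≡ 1ℤ

Arc : {n : ℕ} → Matrix n → GridVertex → GridVertex → Set
Arc {n} A u v = Σ Edge λ e → IsGridEdge n e ×
  ((Forward A e × u ≡ first e × v ≡ second e)
   ⊎ (¬ Forward A e × u ≡ second e × v ≡ first e))

ArcF : {n : ℕ} → Matrix n → GridVertex → GridVertex → Set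
ArcF {n} c u v = ∃ λ (A : Matrix n) → FaceV c A × Arc A u v

DoublyDirected : {n : ℕ} → Matrix n → Edge → Set
DoublyDirected {n} c e =
  IsGridEdge n e × ArcF c (first e) (second e) × ArcF c (second e) (first e)

-- candidate edges incident to a grid vertex (pairwise distinct); the
-- incident grid edges are those among them satisfying IsGridEdge
incident : GridVertex → List Edge
incident (i , j) = vE i j ∷ hE i j ∷ (up i ++ left j)
  where
    up : ℕ → List Edge
    up zero    = []
    up (suc i') = vE i' j ∷ []
    left : ℕ → List Edge
    left zero    = []
    left (suc j') = hE i j' ∷ []

data CountP {A : Set} (P : A → Set) : List A → ℕ → Set where
  c-nil : CountP P [] 0
  c-yes : ∀ {x xs d} → P x → CountP P xs d → CountP P (x ∷ xs) (suc d)
  c-no  : ∀ {x xs d} → ¬ P x → CountP P xs d → CountP P (x ∷ xs) d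

DegreeIs : {n : ℕ} → Matrix n → GridVertex → ℕ → Set
DegreeIs c v d = CountP (DoublyDirected c) (incident v) d

-- every vertex of 𝒢(F) (i.e. every grid vertex of positive degree) has even degree
AllEvenDegree : {n : ℕ} → Matrix n → Set
AllEvenDegree c = ∀ v d → DegreeIs c v d → 1 ≤ d → 2 ∣ d

{-# OPTIONS --safe #-}
-- Column partial sums s_r(M) = Σ_{x ≤ r} m_{xj} are linear in M and take only the values 0
-- and 1 on ASMs: the nonzero entries of a column alternate in sign, so its sums over 1..r
-- and over r+1..n both lie in {-1, 0, 1}, and they add up to 1.
-- For such a 0/1 coordinate and estranged vertices A, B of a face F: if s_r(A) = s_r(B), the
-- face of F on which s_r attains this extreme value contains A and B, hence is F itself.
-- So s_r(A) + s_r(B) is twice the value of s_r on F if s_r is constant on F, and 1 otherwise;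
-- either way it does not depend on the estranged pair. Since a_ij = s_i(A) - s_(i-1)(A),
-- neither does a_ij + b_ij.
module Submission where

open import Defs
open import Data.Nat using (ℕ)
open import Data.Fin using (Fin)
open import Data.Integer using (_+_)
open import Relation.Binary.PropositionalEquality using (_≡_)

open import Data.Fin using (toℕ; fromℕ<)
open import Data.Fin.Properties using (toℕ<n; fromℕ<-toℕ; toℕ-fromℕ<)
open import Data.Integer as ℤ using (ℤ; 0ℤ; 1ℤ; -1ℤ; _*_; -_; +≤+; +<+)
import Data.Integer.Properties as ℤₚ
open import Data.Nat as ℕ using (zero; suc; z≤n; s≤s; s≤s⁻¹; _⊓_; _≤?_; _<?_)
import Data.Nat.Properties as ℕₚ
open import Data.Product using (Σ; ∃-syntax; _×_; _,_; proj₁; proj₂)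
open import Data.Sum as Sum using (_⊎_; inj₁; inj₂)
open import Algebra.Properties.AbelianGroup ℤₚ.+-0-abelianGroup
  using (∙-cancelˡ; \\-leftDividesʳ; xyx⁻¹≈y)
open import Algebra.Properties.CommutativeSemigroup ℤₚ.+-commutativeSemigroup
  using (interchange)
open import Relation.Nullary using (Dec; yes; no; contradiction)
open import Relation.Binary.PropositionalEquality
  using (refl; sym; trans; cong; cong₂; subst; subst₂; _≢_; module ≡-Reasoning)

IsSign : ℤ → Set
IsSign u = u ≡ 0ℤ ⊎ (u ≡ 1ℤ ⊎ u ≡ -1ℤ)

Binary : ℤ → Set
Binary u = u ≡ 0ℤ ⊎ u ≡ 1ℤ

sign*sign<0⇒opposite : ∀ {u v} → IsSign u → IsSign v → u * v ℤ.< 0ℤ → v ≡ - u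
sign*sign<0⇒opposite (inj₁ refl)        _                  (+<+ ())
sign*sign<0⇒opposite (inj₂ (inj₁ refl)) (inj₁ refl)        (+<+ ())
sign*sign<0⇒opposite (inj₂ (inj₁ refl)) (inj₂ (inj₁ refl)) (+<+ ())
sign*sign<0⇒opposite (inj₂ (inj₁ refl)) (inj₂ (inj₂ refl)) _ = refl
sign*sign<0⇒opposite (inj₂ (inj₂ refl)) (inj₁ refl)        (+<+ ())
sign*sign<0⇒opposite (inj₂ (inj₂ refl)) (inj₂ (inj₁ refl)) _ = refl
sign*sign<0⇒opposite (inj₂ (inj₂ refl)) (inj₂ (inj₂ refl)) (+<+ ())

sign+sign≡1⇒binary : ∀ {u v} → IsSign u → IsSign v → u + v ≡ 1ℤ → Binary u
sign+sign≡1⇒binary (inj₁ refl)        _                  _  = inj₁ refl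
sign+sign≡1⇒binary (inj₂ (inj₁ refl)) _                  _  = inj₂ refl
sign+sign≡1⇒binary (inj₂ (inj₂ refl)) (inj₁ refl)        ()
sign+sign≡1⇒binary (inj₂ (inj₂ refl)) (inj₂ (inj₁ refl)) ()
sign+sign≡1⇒binary (inj₂ (inj₂ refl)) (inj₂ (inj₂ refl)) ()

binary∧≢⇒+≡1 : ∀ {u v} → Binary u → Binary v → u ≢ v → u + v ≡ 1ℤ
binary∧≢⇒+≡1 (inj₁ refl) (inj₁ refl) u≢v = contradiction refl u≢v
binary∧≢⇒+≡1 (inj₁ refl) (inj₂ refl) _   = refl
binary∧≢⇒+≡1 (inj₂ refl) (inj₁ refl) _   = refl
binary∧≢⇒+≡1 (inj₂ refl) (inj₂ refl) u≢v = contradiction refl u≢v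

binary⇒0≤ : ∀ {u} → Binary u → 0ℤ ℤ.≤ u
binary⇒0≤ (inj₁ refl) = +≤+ z≤n
binary⇒0≤ (inj₂ refl) = +≤+ z≤n

binary⇒≤1 : ∀ {u} → Binary u → u ℤ.≤ 1ℤ
binary⇒≤1 (inj₁ refl) = +≤+ z≤n
binary⇒≤1 (inj₂ refl) = +≤+ (s≤s z≤n)

+-cancelˡ-≤ : ∀ a {b c} → a + b ℤ.≤ a + c → b ℤ.≤ c
+-cancelˡ-≤ a {b} {c} h =
  subst₂ ℤ._≤_ (\\-leftDividesʳ a b) (\\-leftDividesʳ a c) (ℤₚ.+-monoʳ-≤ (- a) h)

+-cancelʳ-≤ : ∀ a {b c} → b + a ℤ.≤ c + a → b ℤ.≤ c
+-cancelʳ-≤ a {b} {c} h = +-cancelˡ-≤ a (subst₂ ℤ._≤_ (ℤₚ.+-comm b a) (ℤₚ.+-comm c a) h)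

+-cancel-increments : ∀ {a b a′ b′ x y x′ y′} → a + b ≡ a′ + b′ →
  (a + x) + (b + y) ≡ (a′ + x′) + (b′ + y′) → x + y ≡ x′ + y′
+-cancel-increments {a} {b} {a′} {b′} {x} {y} {x′} {y′} ab≡a′b′ eq =
  ∙-cancelˡ (a + b) (x + y) (x′ + y′) (begin
    (a + b) + (x + y)         ≡⟨ interchange a b x y ⟩
    (a + x) + (b + y)         ≡⟨ eq ⟩
    (a′ + x′) + (b′ + y′)     ≡⟨ interchange a′ x′ b′ y′ ⟩
    (a′ + b′) + (x′ + y′)     ≡⟨ cong (_+ (x′ + y′)) ab≡a′b′ ⟨
    (a + b) + (x′ + y′)       ∎)
  where open ≡-Reasoning

sumTo-cong : ∀ m {f g : ℕ → ℤ} → (∀ k → 1 ℕ.≤ k → k ℕ.≤ m → f k ≡ g k) →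
             sumTo m f ≡ sumTo m g
sumTo-cong zero    _   = refl
sumTo-cong (suc m) f≗g = cong₂ _+_
  (sumTo-cong m (λ k 1≤k k≤m → f≗g k 1≤k (ℕₚ.m≤n⇒m≤1+n k≤m)))
  (f≗g (suc m) (s≤s z≤n) ℕₚ.≤-refl)

sumTo-+ : ∀ m (f g : ℕ → ℤ) → sumTo m (λ k → f k + g k) ≡ sumTo m f + sumTo m g
sumTo-+ zero    f g = refl
sumTo-+ (suc m) f g = begin
  sumTo m (λ k → f k + g k) + (f (suc m) + g (suc m))
    ≡⟨ cong (_+ (f (suc m) + g (suc m))) (sumTo-+ m f g) ⟩
  (sumTo m f + sumTo m g) + (f (suc m) + g (suc m))
    ≡⟨ interchange (sumTo m f) (sumTo m g) (f (suc m)) (g (suc m)) ⟩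
  sumTo (suc m) f + sumTo (suc m) g ∎
  where open ≡-Reasoning

sumTo-* : ∀ m s (f : ℕ → ℤ) → sumTo m (λ k → s * f k) ≡ s * sumTo m f
sumTo-* zero    s f = sym (ℤₚ.*-zeroʳ s)
sumTo-* (suc m) s f = begin
  sumTo m (λ k → s * f k) + s * f (suc m) ≡⟨ cong (_+ s * f (suc m)) (sumTo-* m s f) ⟩
  s * sumTo m f + s * f (suc m)           ≡⟨ ℤₚ.*-distribˡ-+ s (sumTo m f) (f (suc m)) ⟨
  s * sumTo (suc m) f                     ∎
  where open ≡-Reasoning

indicator : ∀ {P : Set} → Dec P → ℤ
indicator (yes _) = 1ℤ
indicator (no _)  = 0ℤ

sumTo-indicator≤ : ∀ m r (h : ℕ → ℤ) →
  sumTo m (λ k → indicator (k ≤? r) * h k) ≡ sumTo (m ⊓ r) h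
sumTo-indicator≤ zero    r h = refl
sumTo-indicator≤ (suc m) r h with suc m ≤? r
... | yes m<r = begin
  sumTo m (λ k → indicator (k ≤? r) * h k) + 1ℤ * h (suc m)
    ≡⟨ cong₂ _+_ (sumTo-indicator≤ m r h) (ℤₚ.*-identityˡ (h (suc m))) ⟩
  sumTo (m ⊓ r) h + h (suc m)
    ≡⟨ cong (λ t → sumTo t h + h (suc m)) (ℕₚ.m≤n⇒m⊓n≡m (ℕₚ.<⇒≤ m<r)) ⟩
  sumTo (suc m) h
    ≡⟨ cong (λ t → sumTo t h) (ℕₚ.m≤n⇒m⊓n≡m m<r) ⟨
  sumTo (suc m ⊓ r) h ∎
  where open ≡-Reasoning
... | no m≮r = begin
  sumTo m (λ k → indicator (k ≤? r) * h k) + 0ℤ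
    ≡⟨ ℤₚ.+-identityʳ _ ⟩
  sumTo m (λ k → indicator (k ≤? r) * h k)
    ≡⟨ sumTo-indicator≤ m r h ⟩
  sumTo (m ⊓ r) h
    ≡⟨ cong (λ t → sumTo t h) (trans (ℕₚ.m≥n⇒m⊓n≡n r≤m) (sym (ℕₚ.m≥n⇒m⊓n≡n (ℕₚ.m≤n⇒m≤1+n r≤m)))) ⟩
  sumTo (suc m ⊓ r) h ∎
  where
  open ≡-Reasoning
  r≤m : r ℕ.≤ m
  r≤m = s≤s⁻¹ (ℕₚ.≰⇒> m≮r)

Alternating : (ℕ → ℤ) → Set
Alternating f = ∀ {p q} → p ℕ.< q → f p ≢ 0ℤ → f q ≢ 0ℤ →
  (∀ k → p ℕ.< k → k ℕ.< q → f k ≡ 0ℤ) → f q ≡ - f p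

record LastNonzero (f : ℕ → ℤ) (p q : ℕ) (v : ℤ) : Set where
  field
    position : ℕ
    after    : p ℕ.< position
    upto     : position ℕ.≤ q
    value    : f position ≡ v
    nonzero  : v ≢ 0ℤ
    zeros    : ∀ k → position ℕ.< k → k ℕ.≤ q → f k ≡ 0ℤ

lastNonzero-extend : ∀ {f p q v} → LastNonzero f p q v → f (suc q) ≡ 0ℤ →
                     LastNonzero f p (suc q) v
lastNonzero-extend {f} {q = q} L f≡0 = record
  { position = position ; after = after ; upto = ℕₚ.m≤n⇒m≤1+n upto
  ; value = value ; nonzero = nonzero ; zeros = zeros′ }
  where
  open LastNonzero L
  zeros′ : ∀ k → position ℕ.< k → k ℕ.≤ suc q → f k ≡ 0ℤ
  zeros′ k pos<k k≤1+q with ℕₚ.m≤n⇒m<n∨m≡n k≤1+q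
  ... | inj₁ k<1+q = zeros k pos<k (s≤s⁻¹ k<1+q)
  ... | inj₂ refl  = f≡0

lastNonzero-new : ∀ {f p q} → p ℕ.≤ q → f (suc q) ≢ 0ℤ → LastNonzero f p (suc q) (f (suc q))
lastNonzero-new p≤q f≢0 = record
  { position = _ ; after = s≤s p≤q ; upto = ℕₚ.≤-refl ; value = refl ; nonzero = f≢0
  ; zeros = λ k q<k k≤q → contradiction k≤q (ℕₚ.<⇒≱ q<k) }

module _ {f : ℕ → ℤ} (alternating : Alternating f) where

  SegmentSum : ℕ → ℕ → ℤ → Set
  SegmentSum p q d = sumTo q f ≡ sumTo p f + d × (d ≡ 0ℤ ⊎ LastNonzero f p q d)

  segmentSum-suc : ∀ {p q d} → p ℕ.≤ q → SegmentSum p q d → ∃[ d′ ] SegmentSum p (suc q) d′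
  segmentSum-suc {p} {q} {d} p≤q (sum≡ , last) with f (suc q) ℤ.≟ 0ℤ | last
  ... | yes f≡0 | _ = d , (begin
        sumTo q f + f (suc q) ≡⟨ cong₂ _+_ sum≡ f≡0 ⟩
        (sumTo p f + d) + 0ℤ  ≡⟨ ℤₚ.+-identityʳ _ ⟩
        sumTo p f + d         ∎) , Sum.map₂ (λ L → lastNonzero-extend L f≡0) last
    where open ≡-Reasoning
  ... | no f≢0 | inj₁ refl =
        f (suc q) , cong (_+ f (suc q)) (trans sum≡ (ℤₚ.+-identityʳ (sumTo p f))) ,
        inj₂ (lastNonzero-new p≤q f≢0)
  ... | no f≢0 | inj₂ L = 0ℤ , (begin
        sumTo q f + f (suc q)     ≡⟨ cong₂ _+_ sum≡ f≡-d ⟩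
        (sumTo p f + d) + - d     ≡⟨ ℤₚ.+-assoc (sumTo p f) d (- d) ⟩
        sumTo p f + (d + - d)     ≡⟨ cong (sumTo p f +_) (ℤₚ.+-inverseʳ d) ⟩
        sumTo p f + 0ℤ            ∎) , inj₁ refl
    where
    open ≡-Reasoning
    open LastNonzero L
    f≡-d : f (suc q) ≡ - d
    f≡-d = trans (alternating (s≤s upto) (λ f≡0 → nonzero (trans (sym value) f≡0)) f≢0
                   (λ k pos<k k<1+q → zeros k pos<k (s≤s⁻¹ k<1+q)))
                 (cong -_ value)

  segmentSum : ∀ {p q} → p ℕ.≤ q → ∃[ d ] SegmentSum p q d
  segmentSum {q = zero} z≤n = 0ℤ , sym (ℤₚ.+-identityʳ 0ℤ) , inj₁ refl
  segmentSum {p} {suc q} p≤1+q with ℕₚ.m≤n⇒m<n∨m≡n p≤1+q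
  ... | inj₂ refl  = 0ℤ , sym (ℤₚ.+-identityʳ _) , inj₁ refl
  ... | inj₁ p<1+q = segmentSum-suc (s≤s⁻¹ p<1+q) (proj₂ (segmentSum (s≤s⁻¹ p<1+q)))

  segmentSum-isSign : (∀ k → IsSign (f k)) → ∀ {p q} → p ℕ.≤ q →
    ∃[ d ] sumTo q f ≡ sumTo p f + d × IsSign d
  segmentSum-isSign signs p≤q with segmentSum p≤q
  ... | d , sum≡ , inj₁ d≡0 = d , sum≡ , inj₁ d≡0
  ... | d , sum≡ , inj₂ L   = d , sum≡ , subst IsSign value (signs position)
    where open LastNonzero L

module _ {n : ℕ} where

  tabulate : (ℕ → ℕ → ℤ) → Matrix n
  tabulate f i j = f (suc (toℕ i)) (suc (toℕ j))

  _+ᴹ_ : Matrix n → Matrix n → Matrix n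
  (c +ᴹ e) i j = c i j + e i j

  _*ᴹ_ : ℤ → Matrix n → Matrix n
  (s *ᴹ e) i j = s * e i j

  at-tabulate : ∀ (f : ℕ → ℕ → ℤ) {x y} → 1 ℕ.≤ x → x ℕ.≤ n → 1 ℕ.≤ y → y ℕ.≤ n →
                at (tabulate f) x y ≡ f x y
  at-tabulate f {suc x} {suc y} _ x≤n _ y≤n with x <? n | y <? n
  ... | yes x<n | yes y<n = cong₂ (λ a b → f (suc a) (suc b)) (toℕ-fromℕ< x<n) (toℕ-fromℕ< y<n)
  ... | yes _   | no y≮n  = contradiction y≤n y≮n
  ... | no x≮n  | _       = contradiction x≤n x≮n

  at-toℕ : ∀ (M : Matrix n) i j → at M (suc (toℕ i)) (suc (toℕ j)) ≡ M i j
  at-toℕ M i j with toℕ i <? n | toℕ j <? n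
  ... | yes i<n | yes j<n = cong₂ M (fromℕ<-toℕ i i<n) (fromℕ<-toℕ j j<n)
  ... | yes _   | no j≮n  = contradiction (toℕ<n j) j≮n
  ... | no i≮n  | _       = contradiction (toℕ<n i) i≮n

  at-nonzero⇒row : ∀ (M : Matrix n) x y → at M x y ≢ 0ℤ → Σ (Fin n) λ i → x ≡ suc (toℕ i)
  at-nonzero⇒row M zero    y       at≢0 = contradiction refl at≢0
  at-nonzero⇒row M (suc x) zero    at≢0 = contradiction refl at≢0
  at-nonzero⇒row M (suc x) (suc y) at≢0 with x <? n | y <? n
  ... | yes x<n | yes _ = fromℕ< x<n , cong suc (sym (toℕ-fromℕ< x<n))
  ... | yes _   | no _  = contradiction refl at≢0
  ... | no _    | _     = contradiction refl at≢0

  at-isSign : ∀ {M : Matrix n} → IsASM M → ∀ x y → IsSign (at M x y)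
  at-isSign asm zero    y       = inj₁ refl
  at-isSign asm (suc x) zero    = inj₁ refl
  at-isSign asm (suc x) (suc y) with x <? n | y <? n
  ... | yes _ | yes _ = proj₁ asm _ _
  ... | yes _ | no _  = inj₁ refl
  ... | no _  | _     = inj₁ refl

  at-+ᴹ : ∀ (c e : Matrix n) x y → at (c +ᴹ e) x y ≡ at c x y + at e x y
  at-+ᴹ c e zero    y       = refl
  at-+ᴹ c e (suc x) zero    = refl
  at-+ᴹ c e (suc x) (suc y) with x <? n | y <? n
  ... | yes _ | yes _ = refl
  ... | yes _ | no _  = refl
  ... | no _  | _     = refl

  at-*ᴹ : ∀ s (e : Matrix n) x y → at (s *ᴹ e) x y ≡ s * at e x y
  at-*ᴹ s e zero    y       = sym (ℤₚ.*-zeroʳ s)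
  at-*ᴹ s e (suc x) zero    = sym (ℤₚ.*-zeroʳ s)
  at-*ᴹ s e (suc x) (suc y) with x <? n | y <? n
  ... | yes _ | yes _ = refl
  ... | yes _ | no _  = sym (ℤₚ.*-zeroʳ s)
  ... | no _  | _     = sym (ℤₚ.*-zeroʳ s)

  pair-+ᴹ : ∀ (c e M : Matrix n) → pair (c +ᴹ e) M ≡ pair c M + pair e M
  pair-+ᴹ c e M = begin
    pair (c +ᴹ e) M
      ≡⟨ sumTo-cong n (λ x _ _ → sumTo-cong n (λ y _ _ →
           trans (cong (_* at M x y) (at-+ᴹ c e x y)) (ℤₚ.*-distribʳ-+ (at M x y) (at c x y) (at e x y)))) ⟩
    sumTo n (λ x → sumTo n (λ y → at c x y * at M x y + at e x y * at M x y))
      ≡⟨ sumTo-cong n (λ x _ _ → sumTo-+ n _ _) ⟩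
    sumTo n (λ x → sumTo n (λ y → at c x y * at M x y) + sumTo n (λ y → at e x y * at M x y))
      ≡⟨ sumTo-+ n _ _ ⟩
    pair c M + pair e M ∎
    where open ≡-Reasoning

  pair-*ᴹ : ∀ s (e M : Matrix n) → pair (s *ᴹ e) M ≡ s * pair e M
  pair-*ᴹ s e M = begin
    pair (s *ᴹ e) M
      ≡⟨ sumTo-cong n (λ x _ _ → sumTo-cong n (λ y _ _ →
           trans (cong (_* at M x y) (at-*ᴹ s e x y)) (ℤₚ.*-assoc s (at e x y) (at M x y)))) ⟩
    sumTo n (λ x → sumTo n (λ y → s * (at e x y * at M x y)))
      ≡⟨ sumTo-cong n (λ x _ _ → sumTo-* n s _) ⟩
    sumTo n (λ x → s * sumTo n (λ y → at e x y * at M x y))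
      ≡⟨ sumTo-* n s _ ⟩
    s * pair e M ∎
    where open ≡-Reasoning

  corner : ℕ → ℕ → Matrix n
  corner r y = tabulate (λ x y′ → indicator (x ≤? r) * indicator (y′ ≤? y))

  pair-corner : ∀ {r y} → r ℕ.≤ n → y ℕ.≤ n → (M : Matrix n) →
                pair (corner r y) M ≡ sumTo r (λ x → rowPS M x y)
  pair-corner {r} {y} r≤n y≤n M = begin
    pair (corner r y) M
      ≡⟨ sumTo-cong n (λ x 1≤x x≤n → sumTo-cong n (λ y′ 1≤y′ y′≤n → trans
           (cong (_* at M x y′) (at-tabulate entry 1≤x x≤n 1≤y′ y′≤n))
           (ℤₚ.*-assoc (indicator (x ≤? r)) (indicator (y′ ≤? y)) (at M x y′)))) ⟩
    sumTo n (λ x → sumTo n (λ y′ → indicator (x ≤? r) * (indicator (y′ ≤? y) * at M x y′)))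
      ≡⟨ sumTo-cong n (λ x _ _ → sumTo-* n (indicator (x ≤? r)) _) ⟩
    sumTo n (λ x → indicator (x ≤? r) * sumTo n (λ y′ → indicator (y′ ≤? y) * at M x y′))
      ≡⟨ sumTo-cong n (λ x _ _ → cong (indicator (x ≤? r) *_) (sumTo-indicator≤ n y (at M x))) ⟩
    sumTo n (λ x → indicator (x ≤? r) * sumTo (n ⊓ y) (at M x))
      ≡⟨ sumTo-indicator≤ n r _ ⟩
    sumTo (n ⊓ r) (λ x → sumTo (n ⊓ y) (at M x))
      ≡⟨ cong₂ (λ r′ y′ → sumTo r′ (λ x → sumTo y′ (at M x))) (ℕₚ.m≥n⇒m⊓n≡n r≤n) (ℕₚ.m≥n⇒m⊓n≡n y≤n) ⟩
    sumTo r (λ x → rowPS M x y) ∎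
    where
    open ≡-Reasoning
    entry : ℕ → ℕ → ℤ
    entry x y′ = indicator (x ≤? r) * indicator (y′ ≤? y)

  columnSegment : ℕ → ℕ → Matrix n
  columnSegment r y = corner r (suc y) +ᴹ (-1ℤ *ᴹ corner r y)

  pair-columnSegment : ∀ {r y} → r ℕ.≤ n → y ℕ.< n → (M : Matrix n) →
                       pair (columnSegment r y) M ≡ colPS M r (suc y)
  pair-columnSegment {r} {y} r≤n y<n M = begin
    pair (columnSegment r y) M
      ≡⟨ pair-+ᴹ _ _ M ⟩
    pair (corner r (suc y)) M + pair (-1ℤ *ᴹ corner r y) M
      ≡⟨ cong₂ _+_ (pair-corner r≤n y<n M)
           (trans (pair-*ᴹ -1ℤ _ M) (trans (ℤₚ.-1*i≡-i _) (cong -_ (pair-corner r≤n (ℕₚ.<⇒≤ y<n) M)))) ⟩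
    sumTo r (λ x → rowPS M x y + at M x (suc y)) + - sumTo r (λ x → rowPS M x y)
      ≡⟨ cong (_+ - sumTo r (λ x → rowPS M x y)) (sumTo-+ r _ _) ⟩
    (sumTo r (λ x → rowPS M x y) + colPS M r (suc y)) + - sumTo r (λ x → rowPS M x y)
      ≡⟨ xyx⁻¹≈y (sumTo r (λ x → rowPS M x y)) _ ⟩
    colPS M r (suc y) ∎
    where open ≡-Reasoning

  column-alternating : ∀ {M : Matrix n} → IsASM M → (j : Fin n) →
                       Alternating (λ x → at M x (suc (toℕ j)))
  column-alternating {M} asm j {p} {q} p<q p≢0 q≢0 zeros
    with at-nonzero⇒row M p _ p≢0 | at-nonzero⇒row M q _ q≢0
  ... | i , refl | i′ , refl = begin
    at M (suc (toℕ i′)) (suc (toℕ j)) ≡⟨ at-toℕ M i′ j ⟩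
    M i′ j                            ≡⟨ sign*sign<0⇒opposite (proj₁ asm i j) (proj₁ asm i′ j) M-alternates ⟩
    - M i j                           ≡⟨ cong -_ (at-toℕ M i j) ⟨
    - at M (suc (toℕ i)) (suc (toℕ j)) ∎
    where
    open ≡-Reasoning
    M-alternates : M i j * M i′ j ℤ.< 0ℤ
    M-alternates = proj₂ (proj₂ (proj₂ (proj₂ asm))) j i i′ (s≤s⁻¹ p<q)
      (λ Mij≡0 → p≢0 (trans (at-toℕ M i j) Mij≡0))
      (λ Mi′j≡0 → q≢0 (trans (at-toℕ M i′ j) Mi′j≡0))
      (λ k i<k k<i′ → trans (sym (at-toℕ M k j)) (zeros (suc (toℕ k)) (s≤s i<k) (s≤s k<i′)))

  colPS-binary : ∀ {M : Matrix n} → IsASM M → (j : Fin n) → ∀ {r} → r ℕ.≤ n →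
                 Binary (colPS M r (suc (toℕ j)))
  colPS-binary {M} asm j {r} r≤n
    with segmentSum-isSign (column-alternating asm j) (λ x → at-isSign asm x _) (z≤n {r})
       | segmentSum-isSign (column-alternating asm j) (λ x → at-isSign asm x _) r≤n
  ... | d , prefix≡ , d-sign | d′ , total≡ , d′-sign =
    sign+sign≡1⇒binary (subst IsSign (sym prefix) d-sign) d′-sign (trans (sym total≡) total)
    where
    prefix : colPS M r (suc (toℕ j)) ≡ d
    prefix = trans prefix≡ (ℤₚ.+-identityˡ d)
    total : colPS M n (suc (toℕ j)) ≡ 1ℤ
    total = proj₁ (proj₂ (proj₂ asm)) _ (s≤s z≤n) (toℕ<n j)

  faceV-pair-≡ : ∀ {c A A′ : Matrix n} → FaceV c A → FaceV c A′ → pair c A′ ≡ pair c A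
  faceV-pair-≡ (asmA , maxA) (asmA′ , maxA′) = ℤₚ.≤-antisym (maxA _ asmA′) (maxA′ _ asmA)

  estranged-max⇒constant : ∀ {c A B A′ : Matrix n} (e : Matrix n) → Estranged c A B →
    (∀ M → IsASM M → pair e M ℤ.≤ pair e A) → pair e B ≡ pair e A →
    FaceV c A′ → pair e A′ ≡ pair e A
  estranged-max⇒constant {c} {A} {B} {A′} e (A∈F , B∈F , minimal) e≤eA eB≡eA A′∈F =
    ℤₚ.≤-antisym (e≤eA A′ (proj₁ A′∈F)) eA≤eA′
    where
    open ℤₚ.≤-Reasoning
    -- c′ exposes the face of F on which e attains its maximum, pair e A.
    c′ : Matrix n
    c′ = c +ᴹ e
    c′≤c′A : ∀ M → IsASM M → pair c′ M ℤ.≤ pair c′ A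
    c′≤c′A M asmM = begin
      pair c′ M           ≡⟨ pair-+ᴹ c e M ⟩
      pair c M + pair e M ≤⟨ ℤₚ.+-mono-≤ (proj₂ A∈F M asmM) (e≤eA M asmM) ⟩
      pair c A + pair e A ≡⟨ pair-+ᴹ c e A ⟨
      pair c′ A           ∎
    A∈F′ : FaceV c′ A
    A∈F′ = proj₁ A∈F , c′≤c′A
    B∈F′ : FaceV c′ B
    B∈F′ = proj₁ B∈F , λ M asmM → begin
      pair c′ M           ≤⟨ c′≤c′A M asmM ⟩
      pair c′ A           ≡⟨ pair-+ᴹ c e A ⟩
      pair c A + pair e A ≡⟨ cong₂ _+_ (faceV-pair-≡ A∈F B∈F) eB≡eA ⟨
      pair c B + pair e B ≡⟨ pair-+ᴹ c e B ⟨
      pair c′ B           ∎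
    F′⊆F : c′ ⊆F c
    F′⊆F M (asmM , c′≤c′M) = asmM , λ N asmN → ℤₚ.≤-trans (proj₂ A∈F N asmN) cA≤cM
      where
      cA≤cM : pair c A ℤ.≤ pair c M
      cA≤cM = +-cancelʳ-≤ (pair e A) (begin
        pair c A + pair e A ≡⟨ pair-+ᴹ c e A ⟨
        pair c′ A           ≤⟨ c′≤c′M A (proj₁ A∈F) ⟩
        pair c′ M           ≡⟨ pair-+ᴹ c e M ⟩
        pair c M + pair e M ≤⟨ ℤₚ.+-monoʳ-≤ (pair c M) (e≤eA M asmM) ⟩
        pair c M + pair e A ∎)
    eA≤eA′ : pair e A ℤ.≤ pair e A′
    eA≤eA′ = +-cancelˡ-≤ (pair c A) (begin
      pair c A + pair e A   ≡⟨ pair-+ᴹ c e A ⟨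
      pair c′ A             ≤⟨ proj₂ (minimal c′ F′⊆F A∈F′ B∈F′ A′ A′∈F) A (proj₁ A∈F) ⟩
      pair c′ A′            ≡⟨ pair-+ᴹ c e A′ ⟩
      pair c A′ + pair e A′ ≡⟨ cong (_+ pair e A′) (faceV-pair-≡ A∈F A′∈F) ⟩
      pair c A + pair e A′  ∎)

  estranged-binary-agree : ∀ {c A B A′ : Matrix n} (e : Matrix n) →
    (∀ M → IsASM M → Binary (pair e M)) → Estranged c A B →
    pair e B ≡ pair e A → FaceV c A′ → pair e A′ ≡ pair e A
  estranged-binary-agree {A = A} {B} {A′} e binary E@(A∈F , _) eB≡eA A′∈F
    with binary A (proj₁ A∈F)
  ... | inj₂ eA≡1 = estranged-max⇒constant e E e≤eA eB≡eA A′∈F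
    where
    e≤eA : ∀ M → IsASM M → pair e M ℤ.≤ pair e A
    e≤eA M asmM = subst (pair e M ℤ.≤_) (sym eA≡1) (binary⇒≤1 (binary M asmM))
  ... | inj₁ eA≡0 = ℤₚ.neg-injective (begin
      - pair e A′         ≡⟨ -e≡ A′ ⟨
      pair (-1ℤ *ᴹ e) A′  ≡⟨ estranged-max⇒constant (-1ℤ *ᴹ e) E -e≤-eA
                               (trans (-e≡ B) (trans (cong -_ eB≡eA) (sym (-e≡ A)))) A′∈F ⟩
      pair (-1ℤ *ᴹ e) A   ≡⟨ -e≡ A ⟩
      - pair e A          ∎)
    where
    open ≡-Reasoning
    -e≡ : ∀ M → pair (-1ℤ *ᴹ e) M ≡ - pair e M
    -e≡ M = trans (pair-*ᴹ -1ℤ e M) (ℤₚ.-1*i≡-i (pair e M))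
    -e≤-eA : ∀ M → IsASM M → pair (-1ℤ *ᴹ e) M ℤ.≤ pair (-1ℤ *ᴹ e) A
    -e≤-eA M asmM = subst₂ ℤ._≤_ (sym (-e≡ M)) (sym (-e≡ A))
      (ℤₚ.neg-mono-≤ (subst (ℤ._≤ pair e M) (sym eA≡0) (binary⇒0≤ (binary M asmM))))

  estranged-binary-sum : ∀ {c A B A′ B′ : Matrix n} (e : Matrix n) →
    (∀ M → IsASM M → Binary (pair e M)) → Estranged c A B → Estranged c A′ B′ →
    pair e A + pair e B ≡ pair e A′ + pair e B′
  estranged-binary-sum {A = A} {B} {A′} {B′} e binary E@(A∈F , B∈F , _) E′@(A′∈F , B′∈F , _)
    with pair e A ℤ.≟ pair e B | pair e A′ ℤ.≟ pair e B′
  ... | yes eA≡eB | _ = cong₂ _+_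
        (sym (estranged-binary-agree e binary E (sym eA≡eB) A′∈F))
        (trans (sym eA≡eB) (sym (estranged-binary-agree e binary E (sym eA≡eB) B′∈F)))
  ... | no _ | yes eA′≡eB′ = cong₂ _+_
        (estranged-binary-agree e binary E′ (sym eA′≡eB′) A∈F)
        (trans (estranged-binary-agree e binary E′ (sym eA′≡eB′) B∈F) eA′≡eB′)
  ... | no eA≢eB | no eA′≢eB′ = trans
        (binary∧≢⇒+≡1 (binary A (proj₁ A∈F)) (binary B (proj₁ B∈F)) eA≢eB)
        (sym (binary∧≢⇒+≡1 (binary A′ (proj₁ A′∈F)) (binary B′ (proj₁ B′∈F)) eA′≢eB′))

  colPS-estranged-sum : ∀ {c A B A′ B′ : Matrix n} → Estranged c A B → Estranged c A′ B′ →
    (j : Fin n) → ∀ {r} → r ℕ.≤ n → let y = suc (toℕ j) in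
    colPS A r y + colPS B r y ≡ colPS A′ r y + colPS B′ r y
  colPS-estranged-sum {A = A} {B} {A′} {B′} E E′ j {r} r≤n = begin
    colPS A r y + colPS B r y     ≡⟨ cong₂ _+_ (segment A) (segment B) ⟨
    pair e A + pair e B           ≡⟨ estranged-binary-sum e binary E E′ ⟩
    pair e A′ + pair e B′         ≡⟨ cong₂ _+_ (segment A′) (segment B′) ⟩
    colPS A′ r y + colPS B′ r y   ∎
    where
    open ≡-Reasoning
    y : ℕ
    y = suc (toℕ j)
    e : Matrix n
    e = columnSegment r (toℕ j)
    segment : ∀ M → pair e M ≡ colPS M r y
    segment = pair-columnSegment r≤n (toℕ<n j)
    binary : ∀ M → IsASM M → Binary (pair e M)
    binary M asmM = subst Binary (sym (segment M)) (colPS-binary asmM j r≤n)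

mainTheorem12 : (n : ℕ) (c : Matrix n) → AllEvenDegree c →
    (i j : Fin n) (A B A' B' : Matrix n) →
    Estranged c A B → Estranged c A' B' →
    A i j + B i j ≡ A' i j + B' i j
mainTheorem12 n c _ i j A B A′ B′ E E′ = begin
  A i j + B i j         ≡⟨ cong₂ _+_ (at-toℕ A i j) (at-toℕ B i j) ⟨
  at A x y + at B x y   ≡⟨ +-cancel-increments {prefix A} {prefix B} {prefix A′} {prefix B′}
                             (colPS-estranged-sum E E′ j (ℕₚ.<⇒≤ (toℕ<n i)))
                             (colPS-estranged-sum E E′ j (toℕ<n i)) ⟩
  at A′ x y + at B′ x y ≡⟨ cong₂ _+_ (at-toℕ A′ i j) (at-toℕ B′ i j) ⟩
  A′ i j + B′ i j       ∎
  where
  open ≡-Reasoning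
  x y : ℕ
  x = suc (toℕ i)
  y = suc (toℕ j)
  prefix : Matrix n → ℤ
  prefix M = colPS M (toℕ i) y
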